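{- For $n\ge1$, let $\mathcal I^{\mathrm{val}=\mathrm{des}}_n$ be the set of increasing permutations $\pi$ of length $n$ with $\mathrm{val}(\pi)=\mathrm{des}(\pi)$. Then $$|\mathcal I^{\mathrm{val}=\mathrm{des}}_n|=\sum_{k=0}^{n-1}\sum_{j=k}^{n-1}\left\{ {j \atop k}\right\}k^{\,n-1-j},$$ which is a Gould number (OEIS A040027); here $\left\{ {j \atop k}\right\}$ denotes the Stirling number of the second kind and $0^0=1$.
   Context: A permutation of $[n]$ is written $\pi=\pi_1\cdots\pi_n$. A valley of $\pi$ is an index $\ell$ with $2\le\ell\le n-1$ and $\pi_{\ell-1}>\pi_\ell<\pi_{\ell+1}$; its height is $\pi_\ell$; $\mathrm{val}(\pi)$ is the number of valleys. $\mathrm{des}(\pi)$ is the number of indices $i$ with $\pi_i>\pi_{i+1}$. A permutation is increasing if the heights of its valleys, read from left to right, form an increasing sequence. -}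

module Defs where

open import Data.Nat using (ℕ; zero; suc; _+_; _*_; _∸_; _^_; _<_; _<ᵇ_)
open import Data.Bool using (Bool; true; false; if_then_else_; _∧_)
open import Data.List using (List; []; _∷_; map; upTo; length)
open import Data.Nat.ListAction using (sum)
open import Relation.Binary.PropositionalEquality using (_≡_)
open import Data.List.Relation.Binary.Permutation.Propositional using (_↭_)
open import Data.List.Relation.Unary.Linked using (Linked)
open import Data.List.Relation.Unary.Unique.Propositional using (Unique)
open import Data.List.Membership.Propositional using (_∈_)
open import Data.Product using (_×_; ∃)
open import Function.Bundles using (_⇔_)

range : ℕ → List ℕ
range n = map suc (upTo n)

IsPerm : ℕ → List ℕ → Set
IsPerm n π = π ↭ range n

des : List ℕ → ℕ
des [] = 0
des (x ∷ []) = 0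
des (x ∷ y ∷ r) = (if y <ᵇ x then 1 else 0) + des (y ∷ r)

valleyHeights : List ℕ → List ℕ
valleyHeights (x ∷ y ∷ z ∷ r) =
  if (y <ᵇ x) ∧ (y <ᵇ z) then y ∷ valleyHeights (y ∷ z ∷ r)
                         else valleyHeights (y ∷ z ∷ r)
valleyHeights _ = []

val : List ℕ → ℕ
val π = length (valleyHeights π)

IsIncreasing : List ℕ → Set
IsIncreasing π = Linked _<_ (valleyHeights π)

InI : ℕ → List ℕ → Set
InI n π = IsPerm n π × IsIncreasing π × val π ≡ des π

S2 : ℕ → ℕ → ℕ
S2 zero zero = 1
S2 zero (suc k) = 0
S2 (suc j) zero = 0
S2 (suc j) (suc k) = suc k * S2 j (suc k) + S2 j k

sumFrom : ℕ → ℕ → (ℕ → ℕ) → ℕ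
sumFrom a b f = sum (map (λ i → f (a + i)) (upTo (b ∸ a)))

-- Σ_{k=0}^{n-1} Σ_{j=k}^{n-1} S(j,k) k^{n-1-j}   (Agda's 0 ^ 0 = 1)
gould : ℕ → ℕ
gould n = sumFrom 0 n (λ k → sumFrom k n (λ j → S2 j k * k ^ (n ∸ 1 ∸ j)))

HasCard : (List ℕ → Set) → ℕ → Set
HasCard P m = ∃ λ (L : List (List ℕ)) → Unique L × (∀ π → (π ∈ L) ⇔ P π) × length L ≡ m

-- An increasing permutation has val = des exactly when every descent bottom is a right-to-left
-- minimum and the last step is an ascent.  The permutations of [x+1] whose descent bottoms are
-- right-to-left minima, c of them, arise from those of [x] either by appending x+1 (a new minimum)
-- or by inserting x+1 immediately before one of the c minima; this is the recurrence
-- S(x+1,c) = S(x,c-1) + c S(x,c).  Requiring a final ascent as well forbids inserting before the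
-- last entry, so the number A(x,c) of such permutations satisfies A(x+1,k+1) = S(x,k) + k A(x,k+1),
-- whence A(x+1,k+1) = Σ_{j ≤ x} S(j,k) k^(x-j); summing over k gives the Gould number.
module Submission where

open import Data.Bool using (true; false; _∧_; if_then_else_)
open import Data.Bool.Properties using (if-float)
open import Data.Empty using (⊥-elim)
open import Data.List using (List; []; _∷_; _++_; _∷ʳ_; [_]; map; concatMap; length; last; upTo)
open import Data.List.Membership.Propositional using (_∈_; _∉_; find; lose)
open import Data.List.Membership.Propositional.Properties
  using ( ∈-map⁺; ∈-map⁻; ∈-upTo⁺; ∈-upTo⁻; ∈-∃++; ∈-insert; ∈-concatMap⁺; ∈-concatMap⁻
        ; ∈-++⁺ˡ; ∈-++⁺ʳ; ∈-++⁻)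
open import Data.List.Properties
  using ( ∷-injectiveˡ; ∷-injectiveʳ; ∷ʳ-injective; length-map; length-++; length-upTo; map-++; map-cong-local
        ; upTo-∷ʳ; ++-identityʳ)
open import Data.List.Relation.Binary.Disjoint.Propositional using (Disjoint)
open import Data.List.Relation.Binary.Permutation.Propositional using (_↭_; ↭-refl; ↭-sym; ↭-prep; ↭-swap; ↭-trans)
open import Data.List.Relation.Binary.Permutation.Propositional.Properties
  using (All-resp-↭; ∈-resp-↭; ++⁺ʳ; drop-mid; ∷↭∷ʳ; ↭-empty-inv; ↭-length)
open import Data.List.Relation.Unary.All as All using (All; []; _∷_; all?)
import Data.List.Relation.Unary.All.Properties as AllP
open import Data.List.Relation.Unary.AllPairs as AllPairs using (AllPairs; []; _∷_)
open import Data.List.Relation.Unary.Any using (here; there)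
open import Data.List.Relation.Unary.Linked.Properties using (AllPairs⇒Linked; Linked⇒AllPairs)
open import Data.List.Relation.Unary.Unique.Propositional using (Unique)
import Data.List.Relation.Unary.Unique.Propositional.Properties as UniqueP
open import Data.Maybe using (just)
open import Data.Nat using (ℕ; zero; suc; _+_; _*_; _∸_; _^_; _≤_; _≥_; _<_; _<ᵇ_; _<?_; z≤n; s≤s)
open import Data.Nat.ListAction using (sum)
open import Data.Nat.ListAction.Properties using (sum-++)
open import Data.Nat.Properties
open import Algebra.Properties.CommutativeSemigroup *-commutativeSemigroup using (x∙yz≈y∙xz)
open import Data.Product using (_×_; _,_; proj₁; proj₂; ∃; ∃₂)
open import Data.Sum using (inj₁; inj₂)
open import Data.Unit using (⊤; tt)
open import Function using (_∘_; id)
open import Function.Bundles using (_⇔_; mk⇔; Equivalence)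
open import Relation.Binary.PropositionalEquality
  using (_≡_; _≢_; refl; sym; trans; cong; cong₂; subst; module ≡-Reasoning)
open import Relation.Nullary using (Dec; yes; no; does)
open import Relation.Nullary.Decidable using (dec-false; does-⇔)
open import Relation.Nullary.Reflects using (ofʸ; ofⁿ)

open import Defs

open ≡-Reasoning

-- Increasing permutations with val = des

DescentBottomsAreValleys : List ℕ → Set
DescentBottomsAreValleys (x ∷ y ∷ [])    = x ≤ y
DescentBottomsAreValleys (x ∷ y ∷ z ∷ r) = (y < x → y < z) × DescentBottomsAreValleys (y ∷ z ∷ r)
DescentBottomsAreValleys _               = ⊤

EndsWithAscent : List ℕ → Set
EndsWithAscent (x ∷ y ∷ [])    = x ≤ y
EndsWithAscent (x ∷ y ∷ z ∷ r) = EndsWithAscent (y ∷ z ∷ r)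
EndsWithAscent _               = ⊤

DescentBottomIsRLMin : ℕ → List ℕ → Set
DescentBottomIsRLMin x []      = ⊤
DescentBottomIsRLMin x (y ∷ r) = y < x → All (y <_) r

DescentBottomsAreRLMinima : List ℕ → Set
DescentBottomsAreRLMinima []      = ⊤
DescentBottomsAreRLMinima (x ∷ r) = DescentBottomIsRLMin x r × DescentBottomsAreRLMinima r

val≤des : ∀ π → val π ≤ des π
val≤des (x ∷ y ∷ z ∷ r) with y <ᵇ x | y <ᵇ z | val≤des (y ∷ z ∷ r)
... | true  | true  | ih = s≤s ih
... | true  | false | ih = m≤n⇒m≤1+n ih
... | false | _     | ih = ih
val≤des (x ∷ y ∷ []) = z≤n
val≤des (x ∷ [])     = z≤n
val≤des []           = z≤n

val≡des⇒DescentBottomsAreValleys : ∀ π → val π ≡ des π → DescentBottomsAreValleys π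
val≡des⇒DescentBottomsAreValleys (x ∷ y ∷ []) eq with y <ᵇ x | <ᵇ-reflects-< y x
... | true  | _       = ⊥-elim (0≢1+n eq)
... | false | ofⁿ y≮x = ≮⇒≥ y≮x
val≡des⇒DescentBottomsAreValleys (x ∷ y ∷ z ∷ r) eq
  with val≡des⇒DescentBottomsAreValleys (y ∷ z ∷ r) | y <ᵇ x | <ᵇ-reflects-< y x | y <ᵇ z | <ᵇ-reflects-< y z
... | ih | true  | _       | true  | ofʸ y<z = (λ _ → y<z) , ih (suc-injective eq)
... | ih | true  | _       | false | _       =
  ⊥-elim (<-irrefl refl (≤-trans (≤-reflexive (sym eq)) (val≤des (y ∷ z ∷ r))))
... | ih | false | ofⁿ y≮x | _     | _       = (λ y<x → ⊥-elim (y≮x y<x)) , ih eq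
val≡des⇒DescentBottomsAreValleys []       _ = tt
val≡des⇒DescentBottomsAreValleys (x ∷ []) _ = tt

DescentBottomsAreValleys⇒val≡des : ∀ π → DescentBottomsAreValleys π → val π ≡ des π
DescentBottomsAreValleys⇒val≡des (x ∷ y ∷ []) x≤y with y <ᵇ x | <ᵇ-reflects-< y x
... | true  | ofʸ y<x = ⊥-elim (<⇒≱ y<x x≤y)
... | false | _       = refl
DescentBottomsAreValleys⇒val≡des (x ∷ y ∷ z ∷ r) (valley , d)
  with DescentBottomsAreValleys⇒val≡des (y ∷ z ∷ r) d | y <ᵇ x | <ᵇ-reflects-< y x | y <ᵇ z | <ᵇ-reflects-< y z
... | ih | true  | _       | true  | _       = cong suc ih
... | ih | true  | ofʸ y<x | false | ofⁿ y≮z = ⊥-elim (y≮z (valley y<x))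
... | ih | false | _       | _     | _       = ih
DescentBottomsAreValleys⇒val≡des []       _ = refl
DescentBottomsAreValleys⇒val≡des (x ∷ []) _ = refl

DescentBottomsAreValleys⇒EndsWithAscent : ∀ π → DescentBottomsAreValleys π → EndsWithAscent π
DescentBottomsAreValleys⇒EndsWithAscent (x ∷ y ∷ [])    x≤y    = x≤y
DescentBottomsAreValleys⇒EndsWithAscent (x ∷ y ∷ z ∷ r) (_ , d) = DescentBottomsAreValleys⇒EndsWithAscent (y ∷ z ∷ r) d
DescentBottomsAreValleys⇒EndsWithAscent []              _      = tt
DescentBottomsAreValleys⇒EndsWithAscent (x ∷ [])        _      = tt

RLMinima∧EndsWithAscent⇒DescentBottomsAreValleys :
  ∀ π → DescentBottomsAreRLMinima π → EndsWithAscent π → DescentBottomsAreValleys π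
RLMinima∧EndsWithAscent⇒DescentBottomsAreValleys (x ∷ y ∷ [])    _              x≤y = x≤y
RLMinima∧EndsWithAscent⇒DescentBottomsAreValleys (x ∷ y ∷ z ∷ r) (bottom , rlm) asc =
  (λ y<x → All.head (bottom y<x)) , RLMinima∧EndsWithAscent⇒DescentBottomsAreValleys (y ∷ z ∷ r) rlm asc
RLMinima∧EndsWithAscent⇒DescentBottomsAreValleys []              _              _   = tt
RLMinima∧EndsWithAscent⇒DescentBottomsAreValleys (x ∷ [])        _              _   = tt

All-valleyHeights : ∀ {P : ℕ → Set} x σ → All P σ → All P (valleyHeights (x ∷ σ))
All-valleyHeights x (y ∷ z ∷ r) (py ∷ pzr) with (y <ᵇ x) ∧ (y <ᵇ z)
... | true  = py ∷ All-valleyHeights y (z ∷ r) pzr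
... | false = All-valleyHeights y (z ∷ r) pzr
All-valleyHeights x []       _ = []
All-valleyHeights x (y ∷ []) _ = []

All-valleyHeights-tail : ∀ {P : ℕ → Set} x σ → All P (valleyHeights (x ∷ σ)) → All P (valleyHeights σ)
All-valleyHeights-tail x (y ∷ z ∷ w ∷ r) ps with (y <ᵇ x) ∧ (y <ᵇ z)
... | true  = All.tail ps
... | false = ps
All-valleyHeights-tail x []          _ = []
All-valleyHeights-tail x (y ∷ [])    _ = []
All-valleyHeights-tail x (y ∷ z ∷ []) _ = []

RLMinima⇒valleysIncreasing : ∀ π → DescentBottomsAreRLMinima π → AllPairs _<_ (valleyHeights π)
RLMinima⇒valleysIncreasing (x ∷ y ∷ z ∷ r) (bottom , rlm)
  with RLMinima⇒valleysIncreasing (y ∷ z ∷ r) rlm | y <ᵇ x | <ᵇ-reflects-< y x | y <ᵇ z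
... | ih | true  | ofʸ y<x | true  = All-valleyHeights y (z ∷ r) (bottom y<x) ∷ ih
... | ih | true  | _       | false = ih
... | ih | false | _       | _     = ih
RLMinima⇒valleysIncreasing []           _ = []
RLMinima⇒valleysIncreasing (x ∷ [])     _ = []
RLMinima⇒valleysIncreasing (x ∷ y ∷ []) _ = []

DescentBottomsAreValleys-tail : ∀ x σ → DescentBottomsAreValleys (x ∷ σ) → DescentBottomsAreValleys σ
DescentBottomsAreValleys-tail x (y ∷ z ∷ r) (_ , d) = d
DescentBottomsAreValleys-tail x []          _       = tt
DescentBottomsAreValleys-tail x (y ∷ [])    _       = tt

-- Between consecutive valleys the entries rise, so a lower bound for p and for all valleys
-- bounds every later entry.
valleysAbove⇒entriesAbove : ∀ {b} p σ → b < p → DescentBottomsAreValleys (p ∷ σ) →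
                            All (b <_) (valleyHeights (p ∷ σ)) → All (b <_) σ
valleysAbove⇒entriesAbove {b} p (s ∷ t ∷ r) b<p (valley , d) above
  with valleysAbove⇒entriesAbove {b} s (t ∷ r) | s <ᵇ p | <ᵇ-reflects-< s p | s <ᵇ t | <ᵇ-reflects-< s t
... | ih | true  | _       | true  | _       = All.head above ∷ ih (All.head above) d (All.tail above)
... | ih | true  | ofʸ s<p | false | ofⁿ s≮t = ⊥-elim (s≮t (valley s<p))
... | ih | false | ofⁿ s≮p | _     | _       = b<s ∷ ih b<s d above
  where
  b<s : b < s
  b<s = <-≤-trans b<p (≮⇒≥ s≮p)
valleysAbove⇒entriesAbove p []       _   _   _ = []
valleysAbove⇒entriesAbove p (s ∷ []) b<p p≤s _ = <-≤-trans b<p p≤s ∷ []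

valleysIncreasing⇒RLMinima : ∀ π → AllPairs _<_ (valleyHeights π) → DescentBottomsAreValleys π →
                             DescentBottomsAreRLMinima π
valleysIncreasing⇒RLMinima (x ∷ y ∷ z ∷ r) inc (valley , d)
  with valleysIncreasing⇒RLMinima (y ∷ z ∷ r) | y <ᵇ x | <ᵇ-reflects-< y x | y <ᵇ z | <ᵇ-reflects-< y z
... | ih | true  | _       | true  | ofʸ y<z =
  (λ _ → y<z ∷ valleysAbove⇒entriesAbove z r y<z (DescentBottomsAreValleys-tail y (z ∷ r) d)
                 (All-valleyHeights-tail y (z ∷ r) (AllPairs.head inc)))
  , ih (AllPairs.tail inc) d
... | ih | true  | ofʸ y<x | false | ofⁿ y≮z = ⊥-elim (y≮z (valley y<x))
... | ih | false | ofⁿ y≮x | _     | _       = (λ y<x → ⊥-elim (y≮x y<x)) , ih inc d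
valleysIncreasing⇒RLMinima []           _ _ = tt
valleysIncreasing⇒RLMinima (x ∷ [])     _ _ = tt , tt
valleysIncreasing⇒RLMinima (x ∷ y ∷ []) _ _ = (λ _ → []) , tt , tt

increasing∧val≡des⇔RLMinima∧EndsWithAscent :
  ∀ π → (IsIncreasing π × val π ≡ des π) ⇔ (DescentBottomsAreRLMinima π × EndsWithAscent π)
increasing∧val≡des⇔RLMinima∧EndsWithAscent π = mk⇔
  (λ (inc , eq) → let valleys = val≡des⇒DescentBottomsAreValleys π eq in
     valleysIncreasing⇒RLMinima π (Linked⇒AllPairs <-trans inc) valleys ,
     DescentBottomsAreValleys⇒EndsWithAscent π valleys)
  (λ (rlm , asc) →
     AllPairs⇒Linked (RLMinima⇒valleysIncreasing π rlm) ,
     DescentBottomsAreValleys⇒val≡des π (RLMinima∧EndsWithAscent⇒DescentBottomsAreValleys π rlm asc))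

-- Right-to-left minima and insertion of a new maximum

rlMin? : ∀ y ys → Dec (All (y <_) ys)
rlMin? y ys = all? (y <?_) ys

rlMinima : List ℕ → ℕ
rlMinima []       = 0
rlMinima (y ∷ ys) = if does (rlMin? y ys) then suc (rlMinima ys) else rlMinima ys

n≤if-suc : ∀ b {n} → n ≤ (if b then suc n else n)
n≤if-suc true  = n≤1+n _
n≤if-suc false = ≤-refl

if-suc≤suc : ∀ b {n} → (if b then suc n else n) ≤ suc n
if-suc≤suc true  = ≤-refl
if-suc≤suc false = n≤1+n _

0<rlMinima : ∀ y ys → 0 < rlMinima (y ∷ ys)
0<rlMinima y []       = s≤s z≤n
0<rlMinima y (z ∷ zs) = ≤-trans (0<rlMinima z zs) (n≤if-suc (does (rlMin? y (z ∷ zs))))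

rlMinima≤length : ∀ π → rlMinima π ≤ length π
rlMinima≤length []       = z≤n
rlMinima≤length (y ∷ ys) = ≤-trans (if-suc≤suc (does (rlMin? y ys))) (s≤s (rlMinima≤length ys))

consIf : ∀ {P : Set} {A : Set} → Dec P → A → List A → List A
consIf (yes _) x xs = x ∷ xs
consIf (no _)  x xs = xs

insertBeforeRLMin : ℕ → List ℕ → List (List ℕ)
insertBeforeRLMin v []       = []
insertBeforeRLMin v (y ∷ ys) = consIf (rlMin? y ys) (v ∷ y ∷ ys) (map (y ∷_) (insertBeforeRLMin v ys))

-- Never before the last entry, so that an ascent at the end survives.
insertBeforeInnerRLMin : ℕ → List ℕ → List (List ℕ)
insertBeforeInnerRLMin v (y ∷ z ∷ zs) =
  consIf (rlMin? y (z ∷ zs)) (v ∷ y ∷ z ∷ zs) (map (y ∷_) (insertBeforeInnerRLMin v (z ∷ zs)))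
insertBeforeInnerRLMin v _ = []

data InsertionView (v y : ℕ) (ys : List ℕ) (R : List (List ℕ)) : List ℕ → Set where
  before-head : All (y <_) ys → InsertionView v y ys R (v ∷ y ∷ ys)
  in-tail     : ∀ {τ} → τ ∈ R → InsertionView v y ys R (y ∷ τ)

insertionView : ∀ {v y ys R τ} → τ ∈ consIf (rlMin? y ys) (v ∷ y ∷ ys) (map (y ∷_) R) →
                InsertionView v y ys R τ
insertionView {y = y} {ys} m with rlMin? y ys
... | yes y<ys with m
...   | here refl = before-head y<ys
...   | there m′ with ∈-map⁻ (y ∷_) m′
...     | _ , m″ , refl = in-tail m″
insertionView {y = y} {ys} m | no _ with ∈-map⁻ (y ∷_) m
... | _ , m″ , refl = in-tail m″

insertBeforeRLMin-view : ∀ {τ} v y ys → τ ∈ insertBeforeRLMin v (y ∷ ys) →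
                         InsertionView v y ys (insertBeforeRLMin v ys) τ
insertBeforeRLMin-view v y ys = insertionView

insertBeforeInnerRLMin-view : ∀ {τ} v y z zs → τ ∈ insertBeforeInnerRLMin v (y ∷ z ∷ zs) →
                              InsertionView v y (z ∷ zs) (insertBeforeInnerRLMin v (z ∷ zs)) τ
insertBeforeInnerRLMin-view v y z zs = insertionView

∈-consIf-head : ∀ {P A : Set} (p? : Dec P) {x : A} {xs} → P → x ∈ consIf p? x xs
∈-consIf-head (yes _) _ = here refl
∈-consIf-head (no ¬p) p = ⊥-elim (¬p p)

∈-consIf-tail : ∀ {P A : Set} (p? : Dec P) {x y : A} {xs} → y ∈ xs → y ∈ consIf p? x xs
∈-consIf-tail (yes _) m = there m
∈-consIf-tail (no _)  m = m

consIf-map-∷-unique : ∀ {P A : Set} (p? : Dec P) {v y : A} {σ : List A} {R} → v ≢ y → Unique R →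
                      Unique (consIf p? (v ∷ σ) (map (y ∷_) R))
consIf-map-∷-unique (yes _) v≢y uniq =
  AllP.map⁺ (All.universal (λ _ eq → v≢y (∷-injectiveˡ eq)) _) ∷ UniqueP.map⁺ ∷-injectiveʳ uniq
consIf-map-∷-unique (no _)  v≢y uniq = UniqueP.map⁺ ∷-injectiveʳ uniq

length-consIf-map : ∀ {P A : Set} (p? : Dec P) (x : A) (f : A → A) xs →
                    length (consIf p? x (map f xs)) ≡ (if does p? then suc (length xs) else length xs)
length-consIf-map (yes _) x f xs = cong suc (length-map f xs)
length-consIf-map (no _)  x f xs = length-map f xs

length-insertBeforeRLMin : ∀ v π → length (insertBeforeRLMin v π) ≡ rlMinima π
length-insertBeforeRLMin v []       = refl
length-insertBeforeRLMin v (y ∷ ys) =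
  trans (length-consIf-map (rlMin? y ys) _ (y ∷_) _)
        (cong (λ n → if does (rlMin? y ys) then suc n else n) (length-insertBeforeRLMin v ys))

length-insertBeforeInnerRLMin : ∀ v y ys → suc (length (insertBeforeInnerRLMin v (y ∷ ys))) ≡ rlMinima (y ∷ ys)
length-insertBeforeInnerRLMin v y []       = refl
length-insertBeforeInnerRLMin v y (z ∷ zs) = begin
  suc (length (consIf y<z∷zs? _ (map (y ∷_) inner)))
    ≡⟨ cong suc (length-consIf-map y<z∷zs? _ (y ∷_) inner) ⟩
  suc (if does y<z∷zs? then suc (length inner) else length inner)
    ≡⟨ if-float suc (does y<z∷zs?) ⟩
  (if does y<z∷zs? then suc (suc (length inner)) else suc (length inner))
    ≡⟨ cong (λ n → if does y<z∷zs? then suc n else n) (length-insertBeforeInnerRLMin v z zs) ⟩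
  rlMinima (y ∷ z ∷ zs)
    ∎
  where
  y<z∷zs? : Dec (All (y <_) (z ∷ zs))
  y<z∷zs? = rlMin? y (z ∷ zs)
  inner : List (List ℕ)
  inner = insertBeforeInnerRLMin v (z ∷ zs)

insertBeforeRLMin-↭ : ∀ {τ} v π → τ ∈ insertBeforeRLMin v π → τ ↭ v ∷ π
insertBeforeRLMin-↭ v (y ∷ ys) m with insertBeforeRLMin-view v y ys m
... | before-head _ = ↭-refl
... | in-tail m′    = ↭-trans (↭-prep y (insertBeforeRLMin-↭ v ys m′)) (↭-swap y v ↭-refl)

insertBeforeRLMin-injective : ∀ {τ} v π π′ → All (_< v) π → All (_< v) π′ →
                              τ ∈ insertBeforeRLMin v π → τ ∈ insertBeforeRLMin v π′ → π ≡ π′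
insertBeforeRLMin-injective v (y ∷ ys) (y′ ∷ ys′) (y<v ∷ ys<v) (y′<v ∷ ys′<v) m m′
  with insertBeforeRLMin-view v y ys m | insertBeforeRLMin-view v y′ ys′ m′
... | before-head _ | before-head _ = refl
... | before-head _ | in-tail _     = ⊥-elim (<-irrefl refl y′<v)
... | in-tail _     | before-head _ = ⊥-elim (<-irrefl refl y<v)
... | in-tail mt    | in-tail mt′   = cong (y ∷_) (insertBeforeRLMin-injective v ys ys′ ys<v ys′<v mt mt′)

insertBeforeRLMin-unique : ∀ v π → All (_< v) π → Unique (insertBeforeRLMin v π)
insertBeforeRLMin-unique v []       _            = []
insertBeforeRLMin-unique v (y ∷ ys) (y<v ∷ ys<v) =
  consIf-map-∷-unique (rlMin? y ys) (λ v≡y → <-irrefl (sym v≡y) y<v) (insertBeforeRLMin-unique v ys ys<v)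

insertBeforeInnerRLMin-unique : ∀ v π → All (_< v) π → Unique (insertBeforeInnerRLMin v π)
insertBeforeInnerRLMin-unique v (y ∷ z ∷ zs) (y<v ∷ zs<v) =
  consIf-map-∷-unique (rlMin? y (z ∷ zs)) (λ v≡y → <-irrefl (sym v≡y) y<v)
    (insertBeforeInnerRLMin-unique v (z ∷ zs) zs<v)
insertBeforeInnerRLMin-unique v []       _ = []
insertBeforeInnerRLMin-unique v (y ∷ []) _ = []

insertBeforeInnerRLMin⊆insertBeforeRLMin : ∀ {τ} v π → τ ∈ insertBeforeInnerRLMin v π → τ ∈ insertBeforeRLMin v π
insertBeforeInnerRLMin⊆insertBeforeRLMin v (y ∷ z ∷ zs) m with insertBeforeInnerRLMin-view v y z zs m
... | before-head y<zs = ∈-consIf-head (rlMin? y (z ∷ zs)) y<zs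
... | in-tail m′ = ∈-consIf-tail (rlMin? y (z ∷ zs))
                     (∈-map⁺ (y ∷_) (insertBeforeInnerRLMin⊆insertBeforeRLMin v (z ∷ zs) m′))

last-insertBeforeRLMin : ∀ {τ} v π → τ ∈ insertBeforeRLMin v π → last τ ≡ last π
last-insertBeforeRLMin v (y ∷ []) m with insertBeforeRLMin-view v y [] m
... | before-head _ = refl
... | in-tail ()
last-insertBeforeRLMin v (y ∷ z ∷ zs) m with insertBeforeRLMin-view v y (z ∷ zs) m
... | before-head _ = refl
-- The second view only exposes τ′ as a cons, so that last (y ∷ τ′) computes.
... | in-tail m′ with insertBeforeRLMin-view v z zs m′ | last-insertBeforeRLMin v (z ∷ zs) m′
...   | before-head _ | ih = ih
...   | in-tail _     | ih = ih

last-∷ʳ : ∀ {A : Set} xs (v : A) → last (xs ∷ʳ v) ≡ just v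
last-∷ʳ []          v = refl
last-∷ʳ (x ∷ [])    v = refl
last-∷ʳ (x ∷ y ∷ r) v = last-∷ʳ (y ∷ r) v

All-last : ∀ {A : Set} {P : A → Set} {z} xs → All P xs → last xs ≡ just z → P z
All-last (x ∷ [])    (px ∷ []) refl = px
All-last (x ∷ y ∷ r) (_ ∷ ps)  eq   = All-last (y ∷ r) ps eq

∷ʳ∉insertBeforeRLMin : ∀ v xs π → All (_< v) π → xs ∷ʳ v ∉ insertBeforeRLMin v π
∷ʳ∉insertBeforeRLMin v xs π π<v m =
  <-irrefl refl (All-last π π<v (trans (sym (last-insertBeforeRLMin v π m)) (last-∷ʳ xs v)))

insertBeforeRLMin-∷∷ : ∀ {τ} v π → τ ∈ insertBeforeRLMin v π → ∃₂ λ a b → ∃ λ σ → τ ≡ a ∷ b ∷ σ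
insertBeforeRLMin-∷∷ v (y ∷ ys) m with insertBeforeRLMin-view v y ys m
... | before-head _ = _ , _ , _ , refl
insertBeforeRLMin-∷∷ v (y ∷ z ∷ zs) m | in-tail m′ with insertBeforeRLMin-view v z zs m′
... | before-head _ = _ , _ , _ , refl
... | in-tail _     = _ , _ , _ , refl

insertBeforeInnerRLMin-EndsWithAscent : ∀ {τ} v π → τ ∈ insertBeforeInnerRLMin v π →
                                        EndsWithAscent π → EndsWithAscent τ
insertBeforeInnerRLMin-EndsWithAscent v (y ∷ z ∷ zs) m asc with insertBeforeInnerRLMin-view v y z zs m
... | before-head _ = asc
insertBeforeInnerRLMin-EndsWithAscent v (y ∷ z ∷ w ∷ ws) m asc | in-tail m′
  with insertBeforeRLMin-∷∷ v (z ∷ w ∷ ws) (insertBeforeInnerRLMin⊆insertBeforeRLMin v (z ∷ w ∷ ws) m′)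
... | _ , _ , _ , refl = insertBeforeInnerRLMin-EndsWithAscent v (z ∷ w ∷ ws) m′ asc

insertBeforeRLMin-EndsWithAscent⁻ : ∀ {τ} v π → All (_< v) π → τ ∈ insertBeforeRLMin v π →
                                    EndsWithAscent τ → EndsWithAscent π
insertBeforeRLMin-EndsWithAscent⁻ v (y ∷ []) (y<v ∷ []) m v≤y with insertBeforeRLMin-view v y [] m
... | before-head _ = ⊥-elim (<⇒≱ y<v v≤y)
insertBeforeRLMin-EndsWithAscent⁻ v (y ∷ z ∷ zs) (_ ∷ zs<v) m asc with insertBeforeRLMin-view v y (z ∷ zs) m
... | before-head _ = asc
insertBeforeRLMin-EndsWithAscent⁻ v (y ∷ z ∷ []) (_ ∷ z<v ∷ []) m v≤z | in-tail m′
  with insertBeforeRLMin-view v z [] m′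
... | before-head _ = ⊥-elim (<⇒≱ z<v v≤z)
insertBeforeRLMin-EndsWithAscent⁻ v (y ∷ z ∷ w ∷ ws) (_ ∷ zs<v) m asc | in-tail m′
  with insertBeforeRLMin-∷∷ v (z ∷ w ∷ ws) m′
... | _ , _ , _ , refl = insertBeforeRLMin-EndsWithAscent⁻ v (z ∷ w ∷ ws) zs<v m′ asc

insertBeforeRLMin⇒insertBeforeInnerRLMin : ∀ {τ} v π → All (_< v) π → τ ∈ insertBeforeRLMin v π →
                                           EndsWithAscent τ → τ ∈ insertBeforeInnerRLMin v π
insertBeforeRLMin⇒insertBeforeInnerRLMin v (y ∷ []) (y<v ∷ []) m v≤y with insertBeforeRLMin-view v y [] m
... | before-head _ = ⊥-elim (<⇒≱ y<v v≤y)
insertBeforeRLMin⇒insertBeforeInnerRLMin v (y ∷ z ∷ zs) (_ ∷ zs<v) m asc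
  with insertBeforeRLMin-view v y (z ∷ zs) m
... | before-head y<zs = ∈-consIf-head (rlMin? y (z ∷ zs)) y<zs
... | in-tail m′ with insertBeforeRLMin-∷∷ v (z ∷ zs) m′
...   | _ , _ , _ , refl = ∈-consIf-tail (rlMin? y (z ∷ zs))
                             (∈-map⁺ (y ∷_) (insertBeforeRLMin⇒insertBeforeInnerRLMin v (z ∷ zs) zs<v m′ asc))

All<-↭-∷ : ∀ {y v xs ys} → y < v → xs ↭ v ∷ ys → All (y <_) xs ⇔ All (y <_) ys
All<-↭-∷ y<v p = mk⇔ (λ xs>y → All.tail (All-resp-↭ p xs>y)) (λ ys>y → All-resp-↭ (↭-sym p) (y<v ∷ ys>y))

rlMinima-∷ : ∀ y {xs ys} → All (y <_) xs ⇔ All (y <_) ys →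
             rlMinima (y ∷ xs) ≡ (if does (rlMin? y ys) then suc (rlMinima xs) else rlMinima xs)
rlMinima-∷ y {xs} {ys} same =
  cong (λ b → if b then suc (rlMinima xs) else rlMinima xs) (does-⇔ same (rlMin? y xs) (rlMin? y ys))

rlMinima-insertBeforeRLMin : ∀ {τ} v π → All (_< v) π → τ ∈ insertBeforeRLMin v π → rlMinima τ ≡ rlMinima π
rlMinima-insertBeforeRLMin v (y ∷ ys) (y<v ∷ ys<v) m with insertBeforeRLMin-view v y ys m
... | before-head _ =
  cong (λ b → if b then suc (rlMinima (y ∷ ys)) else rlMinima (y ∷ ys))
       (dec-false (rlMin? v (y ∷ ys)) (λ v<y∷ys → <-asym y<v (All.head v<y∷ys)))
... | in-tail m′ =
  trans (rlMinima-∷ y (All<-↭-∷ y<v (insertBeforeRLMin-↭ v ys m′)))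
        (cong (λ n → if does (rlMin? y ys) then suc n else n) (rlMinima-insertBeforeRLMin v ys ys<v m′))

DescentBottomIsRLMin-insertBeforeRLMin : ∀ {τ} v y ys → y < v → All (_< v) ys →
  τ ∈ insertBeforeRLMin v ys → DescentBottomIsRLMin y ys → DescentBottomIsRLMin y τ
DescentBottomIsRLMin-insertBeforeRLMin v y (z ∷ zs) y<v (z<v ∷ _) m bottom with insertBeforeRLMin-view v z zs m
... | before-head _ = λ v<y → ⊥-elim (<-asym v<y y<v)
... | in-tail m′    = λ z<y → Equivalence.from (All<-↭-∷ z<v (insertBeforeRLMin-↭ v zs m′)) (bottom z<y)

DescentBottomIsRLMin-insertBeforeRLMin⁻ : ∀ {τ} v y ys → All (_< v) ys → τ ∈ insertBeforeRLMin v ys →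
  DescentBottomIsRLMin y τ → DescentBottomsAreRLMinima τ → DescentBottomIsRLMin y ys
DescentBottomIsRLMin-insertBeforeRLMin⁻ v y (z ∷ zs) (z<v ∷ _) m bottom rlm with insertBeforeRLMin-view v z zs m
... | before-head _ = λ _ → proj₁ rlm z<v
... | in-tail m′    = λ z<y → Equivalence.to (All<-↭-∷ z<v (insertBeforeRLMin-↭ v zs m′)) (bottom z<y)

RLMinima-insertBeforeRLMin : ∀ {τ} v π → All (_< v) π → τ ∈ insertBeforeRLMin v π →
                             DescentBottomsAreRLMinima π → DescentBottomsAreRLMinima τ
RLMinima-insertBeforeRLMin v (y ∷ ys) (y<v ∷ ys<v) m (bottom , rlm) with insertBeforeRLMin-view v y ys m
... | before-head y<ys = (λ _ → y<ys) , bottom , rlm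
... | in-tail m′       = DescentBottomIsRLMin-insertBeforeRLMin v y ys y<v ys<v m′ bottom
                       , RLMinima-insertBeforeRLMin v ys ys<v m′ rlm

RLMinima-insertBeforeRLMin⁻ : ∀ {τ} v π → All (_< v) π → τ ∈ insertBeforeRLMin v π →
                              DescentBottomsAreRLMinima τ → DescentBottomsAreRLMinima π
RLMinima-insertBeforeRLMin⁻ v (y ∷ ys) (y<v ∷ ys<v) m rlm with insertBeforeRLMin-view v y ys m
... | before-head _ = proj₂ rlm
... | in-tail m′    = DescentBottomIsRLMin-insertBeforeRLMin⁻ v y ys ys<v m′ (proj₁ rlm) (proj₂ rlm)
                    , RLMinima-insertBeforeRLMin⁻ v ys ys<v m′ (proj₂ rlm)

∈-insertBeforeRLMin : ∀ v xs y ys → All (_< v) (xs ++ y ∷ ys) → DescentBottomsAreRLMinima (xs ++ v ∷ y ∷ ys) →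
                      xs ++ v ∷ y ∷ ys ∈ insertBeforeRLMin v (xs ++ y ∷ ys)
∈-insertBeforeRLMin v []       y ys (y<v ∷ _) (bottom , _) = ∈-consIf-head (rlMin? y ys) (bottom y<v)
∈-insertBeforeRLMin v (x ∷ xs) y ys (_ ∷ <v)  (_ , rlm)    =
  ∈-consIf-tail (rlMin? x (xs ++ y ∷ ys)) (∈-map⁺ (x ∷_) (∈-insertBeforeRLMin v xs y ys <v rlm))

-- Permutations of [x] and their maximum

range-suc : ∀ x → range (suc x) ≡ range x ∷ʳ suc x
range-suc x = trans (cong (map suc) (sym (upTo-∷ʳ x))) (map-++ suc (upTo x) [ x ])

length-range : ∀ x → length (range x) ≡ x
length-range x = trans (length-map suc (upTo x)) (length-upTo x)

↭range⇒All< : ∀ {x π} → π ↭ range x → All (_< suc x) π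
↭range⇒All< p = All-resp-↭ (↭-sym p) (AllP.map⁺ (All.tabulate (λ i∈ → s≤s (∈-upTo⁻ i∈))))

↭range-∷ʳ : ∀ {x π} → π ↭ range x → π ∷ʳ suc x ↭ range (suc x)
↭range-∷ʳ {x} p rewrite range-suc x = ++⁺ʳ [ _ ] p

↭range-insert : ∀ {x π τ} → π ↭ range x → τ ↭ suc x ∷ π → τ ↭ range (suc x)
↭range-insert {x} p q rewrite range-suc x = ↭-trans q (↭-trans (↭-prep (suc x) p) (∷↭∷ʳ (suc x) (range x)))

RLMinima-∷ʳ : ∀ v xs → All (_< v) xs → DescentBottomsAreRLMinima xs → DescentBottomsAreRLMinima (xs ∷ʳ v)
RLMinima-∷ʳ v []           _               _             = tt , tt
RLMinima-∷ʳ v (x ∷ [])     _               _             = (λ _ → []) , tt , tt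
RLMinima-∷ʳ v (x ∷ z ∷ r) (_ ∷ z<v ∷ r<v) (bottom , rlm) =
  (λ z<x → AllP.++⁺ (bottom z<x) (z<v ∷ [])) , RLMinima-∷ʳ v (z ∷ r) (z<v ∷ r<v) rlm

RLMinima-++⁻ : ∀ xs ys → DescentBottomsAreRLMinima (xs ++ ys) → DescentBottomsAreRLMinima xs
RLMinima-++⁻ []          ys _              = tt
RLMinima-++⁻ (x ∷ [])    ys _              = tt , tt
RLMinima-++⁻ (x ∷ z ∷ r) ys (bottom , rlm) =
  (λ z<x → AllP.++⁻ˡ r (bottom z<x)) , RLMinima-++⁻ (z ∷ r) ys rlm

EndsWithAscent-∷ʳ : ∀ v xs → All (_< v) xs → EndsWithAscent (xs ∷ʳ v)
EndsWithAscent-∷ʳ v []              _             = tt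
EndsWithAscent-∷ʳ v (x ∷ [])        (x<v ∷ _)     = <⇒≤ x<v
EndsWithAscent-∷ʳ v (x ∷ z ∷ [])    (_ ∷ z<v ∷ _) = <⇒≤ z<v
EndsWithAscent-∷ʳ v (x ∷ z ∷ w ∷ r) (_ ∷ <v)      = EndsWithAscent-∷ʳ v (z ∷ w ∷ r) <v

rlMinima-∷ʳ : ∀ v xs → All (_< v) xs → rlMinima (xs ∷ʳ v) ≡ suc (rlMinima xs)
rlMinima-∷ʳ v []       _          = refl
rlMinima-∷ʳ v (y ∷ ys) (y<v ∷ <v) =
  trans (rlMinima-∷ y (mk⇔ (AllP.++⁻ˡ ys) (λ ys>y → AllP.++⁺ ys>y (y<v ∷ []))))
        (trans (cong (λ n → if does (rlMin? y ys) then suc n else n) (rlMinima-∷ʳ v ys <v))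
               (sym (if-float suc (does (rlMin? y ys)))))

data MaxRemoved (x : ℕ) : List ℕ → Set where
  appended : ∀ {π} → π ↭ range x → DescentBottomsAreRLMinima π → MaxRemoved x (π ∷ʳ suc x)
  inserted : ∀ {π τ} → π ↭ range x → DescentBottomsAreRLMinima π → τ ∈ insertBeforeRLMin (suc x) π →
             MaxRemoved x τ

-- Removing the maximum keeps the descent bottoms right-to-left minima; and since the entry
-- that followed the maximum was a descent bottom, the maximum went in front of a minimum.
removeMax : ∀ x σ → σ ↭ range (suc x) → DescentBottomsAreRLMinima σ → MaxRemoved x σ
removeMax x σ σ↭ rlm with ∈-∃++ (∈-resp-↭ (↭-sym σ↭) (subst (suc x ∈_) (sym (range-suc x)) (∈-insert (range x))))
... | xs , ys , refl = split ys (subst (xs ++ ys ↭_) (++-identityʳ (range x))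
                                   (drop-mid xs (range x) (subst (σ ↭_) (range-suc x) σ↭))) rlm
  where
  split : ∀ ys → xs ++ ys ↭ range x → DescentBottomsAreRLMinima (xs ++ suc x ∷ ys) → MaxRemoved x (xs ++ suc x ∷ ys)
  split []       π↭ rlm = appended xs↭ (RLMinima-++⁻ xs [ suc x ] rlm)
    where
    xs↭ : xs ↭ range x
    xs↭ = subst (_↭ range x) (++-identityʳ xs) π↭
  split (y ∷ ys) π↭ rlm =
    inserted π↭ (RLMinima-insertBeforeRLMin⁻ (suc x) π <v mem rlm) mem
    where
    π : List ℕ
    π = xs ++ y ∷ ys
    <v : All (_< suc x) π
    <v = ↭range⇒All< π↭
    mem : xs ++ suc x ∷ y ∷ ys ∈ insertBeforeRLMin (suc x) π
    mem = ∈-insertBeforeRLMin (suc x) xs y ys <v rlm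

-- Enumeration

unique-concatMap : ∀ {A B : Set} (f : A → List B) {L} → Unique L → (∀ {a} → a ∈ L → Unique (f a)) →
                   (∀ {a a′ b} → a ∈ L → a′ ∈ L → b ∈ f a → b ∈ f a′ → a ≡ a′) → Unique (concatMap f L)
unique-concatMap f {[]}    _          _      _     = []
unique-concatMap f {a ∷ L} (a∉L ∷ uL) unique apart =
  UniqueP.++⁺ (unique (here refl))
    (unique-concatMap f uL (unique ∘ there) (λ a∈ a′∈ → apart (there a∈) (there a′∈)))
    disjoint
  where
  disjoint : Disjoint (f a) (concatMap f L)
  disjoint (b∈fa , b∈rest) with find (∈-concatMap⁻ f b∈rest)
  ... | a′ , a′∈L , b∈fa′ = All.lookup a∉L a′∈L (apart (here refl) (there a′∈L) b∈fa b∈fa′)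

length-concatMap : ∀ {A B : Set} (f : A → List B) L → length (concatMap f L) ≡ sum (map (length ∘ f) L)
length-concatMap f []      = refl
length-concatMap f (a ∷ L) = trans (length-++ (f a)) (cong (length (f a) +_) (length-concatMap f L))

length-concatMap-const : ∀ {A B : Set} (f : A → List B) L k → (∀ {a} → a ∈ L → length (f a) ≡ k) →
                         length (concatMap f L) ≡ length L * k
length-concatMap-const f []      k _     = refl
length-concatMap-const f (a ∷ L) k const =
  trans (length-++ (f a)) (cong₂ _+_ (const (here refl)) (length-concatMap-const f L k (const ∘ there)))

RLPerm : ℕ → ℕ → List ℕ → Set
RLPerm x c π = π ↭ range x × DescentBottomsAreRLMinima π × rlMinima π ≡ c

RLAscPerm : ℕ → ℕ → List ℕ → Set
RLAscPerm x c π = RLPerm x c π × EndsWithAscent π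

RLAscPerm⇒rlMinima≡ : ∀ {x c π} → RLAscPerm x c π → rlMinima π ≡ c
RLAscPerm⇒rlMinima≡ ((_ , _ , eq) , _) = eq

RLPerm-∷ʳ : ∀ {x c π} → RLPerm x c π → RLAscPerm (suc x) (suc c) (π ∷ʳ suc x)
RLPerm-∷ʳ {x} {π = π} (π↭ , rlm , refl) =
  (↭range-∷ʳ π↭ , RLMinima-∷ʳ (suc x) π <v rlm , rlMinima-∷ʳ (suc x) π <v) , EndsWithAscent-∷ʳ (suc x) π <v
  where
  <v : All (_< suc x) π
  <v = ↭range⇒All< π↭

RLPerm-insert : ∀ {x c π τ} → RLPerm x c π → τ ∈ insertBeforeRLMin (suc x) π → RLPerm (suc x) c τ
RLPerm-insert {x} {π = π} (π↭ , rlm , refl) τ∈ =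
  ↭range-insert π↭ (insertBeforeRLMin-↭ (suc x) π τ∈) ,
  RLMinima-insertBeforeRLMin (suc x) π <v τ∈ rlm ,
  rlMinima-insertBeforeRLMin (suc x) π <v τ∈
  where
  <v : All (_< suc x) π
  <v = ↭range⇒All< π↭

mutual
  withMaxAppended : ℕ → ℕ → List (List ℕ)
  withMaxAppended x zero    = []
  withMaxAppended x (suc c) = map (_∷ʳ suc x) (rlPerms x c)

  rlPerms : ℕ → ℕ → List (List ℕ)
  rlPerms zero    zero    = [ [] ]
  rlPerms zero    (suc c) = []
  rlPerms (suc x) c       = withMaxAppended x c ++ concatMap (insertBeforeRLMin (suc x)) (rlPerms x c)

rlAscPerms : ℕ → ℕ → List (List ℕ)
rlAscPerms zero    zero    = [ [] ]
rlAscPerms zero    (suc c) = []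
rlAscPerms (suc x) c       = withMaxAppended x c ++ concatMap (insertBeforeInnerRLMin (suc x)) (rlAscPerms x c)

mutual
  withMaxAppended-sound : ∀ x c {τ} → τ ∈ withMaxAppended x c → RLAscPerm (suc x) c τ
  withMaxAppended-sound x (suc c) τ∈ with ∈-map⁻ (_∷ʳ suc x) τ∈
  ... | π , π∈ , refl = RLPerm-∷ʳ (rlPerms-sound x c π∈)

  rlPerms-sound : ∀ x c {τ} → τ ∈ rlPerms x c → RLPerm x c τ
  rlPerms-sound zero    zero (here refl) = ↭-refl , tt , refl
  rlPerms-sound (suc x) c    τ∈ with ∈-++⁻ (withMaxAppended x c) τ∈
  ... | inj₁ τ∈appended = proj₁ (withMaxAppended-sound x c τ∈appended)
  ... | inj₂ τ∈inserted with find (∈-concatMap⁻ _ τ∈inserted)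
  ...   | π , π∈ , τ∈π = RLPerm-insert (rlPerms-sound x c π∈) τ∈π

rlAscPerms-sound : ∀ x c {τ} → τ ∈ rlAscPerms x c → RLAscPerm x c τ
rlAscPerms-sound zero    zero (here refl) = (↭-refl , tt , refl) , tt
rlAscPerms-sound (suc x) c    τ∈ with ∈-++⁻ (withMaxAppended x c) τ∈
... | inj₁ τ∈appended = withMaxAppended-sound x c τ∈appended
... | inj₂ τ∈inserted with find (∈-concatMap⁻ _ τ∈inserted)
...   | π , π∈ , τ∈π with rlAscPerms-sound x c π∈
...     | π-rl , asc =
  RLPerm-insert π-rl (insertBeforeInnerRLMin⊆insertBeforeRLMin (suc x) π τ∈π) ,
  insertBeforeInnerRLMin-EndsWithAscent (suc x) π τ∈π asc

RLPerm-zero : ∀ {c τ} → RLPerm zero c τ → c ≡ zero × τ ≡ []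
RLPerm-zero (τ↭ , _ , refl) with ↭-empty-inv τ↭
... | refl = refl , refl

mutual
  ∈-withMaxAppended : ∀ {x c π} → RLPerm x c π → π ∷ʳ suc x ∈ withMaxAppended x (suc c)
  ∈-withMaxAppended π-rl = ∈-map⁺ (_∷ʳ suc _) (rlPerms-complete π-rl)

  rlPerms-complete : ∀ {x c τ} → RLPerm x c τ → τ ∈ rlPerms x c
  rlPerms-complete {zero} τ-rl with RLPerm-zero τ-rl
  ... | refl , refl = here refl
  rlPerms-complete {suc x} {τ = τ} (τ↭ , rlm , refl) with removeMax x _ τ↭ rlm
  ... | appended π↭ π-rlm rewrite rlMinima-∷ʳ (suc x) _ (↭range⇒All< π↭) =
    ∈-++⁺ˡ (∈-withMaxAppended (π↭ , π-rlm , refl))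
  ... | inserted {π} π↭ π-rlm τ∈π =
    ∈-++⁺ʳ (withMaxAppended x (rlMinima τ)) (∈-concatMap⁺ _ (lose (rlPerms-complete π-rl) τ∈π))
    where
    π-rl : RLPerm x (rlMinima τ) π
    π-rl = π↭ , π-rlm , sym (rlMinima-insertBeforeRLMin (suc x) π (↭range⇒All< π↭) τ∈π)

rlAscPerms-complete : ∀ {x c τ} → RLAscPerm x c τ → τ ∈ rlAscPerms x c
rlAscPerms-complete {zero} (τ-rl , _) with RLPerm-zero τ-rl
... | refl , refl = here refl
rlAscPerms-complete {suc x} {τ = τ} ((τ↭ , rlm , refl) , asc) with removeMax x _ τ↭ rlm
... | appended π↭ π-rlm rewrite rlMinima-∷ʳ (suc x) _ (↭range⇒All< π↭) =
  ∈-++⁺ˡ (∈-withMaxAppended (π↭ , π-rlm , refl))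
... | inserted {π} π↭ π-rlm τ∈π =
  ∈-++⁺ʳ (withMaxAppended x (rlMinima τ))
    (∈-concatMap⁺ _ (lose (rlAscPerms-complete π-rlasc)
                          (insertBeforeRLMin⇒insertBeforeInnerRLMin (suc x) π <v τ∈π asc)))
  where
  <v : All (_< suc x) π
  <v = ↭range⇒All< π↭
  π-rlasc : RLAscPerm x (rlMinima τ) π
  π-rlasc = (π↭ , π-rlm , sym (rlMinima-insertBeforeRLMin (suc x) π <v τ∈π)) ,
            insertBeforeRLMin-EndsWithAscent⁻ (suc x) π <v τ∈π asc

withMaxAppended-unique : ∀ x c → (∀ c → Unique (rlPerms x c)) → Unique (withMaxAppended x c)
withMaxAppended-unique x zero    _              = []
withMaxAppended-unique x (suc c) unique-rlPerms =
  UniqueP.map⁺ (λ {xs} {ys} eq → proj₁ (∷ʳ-injective xs ys eq)) (unique-rlPerms c)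

withMaxAppended∉insertBeforeRLMin : ∀ x c {τ π} → τ ∈ withMaxAppended x c → All (_< suc x) π →
                                    τ ∉ insertBeforeRLMin (suc x) π
withMaxAppended∉insertBeforeRLMin x (suc c) τ∈ π<v with ∈-map⁻ (_∷ʳ suc x) τ∈
... | xs , _ , refl = ∷ʳ∉insertBeforeRLMin (suc x) xs _ π<v

unique-extensions : ∀ x c (f : List ℕ → List (List ℕ)) {L} →
                    (∀ {π τ} → τ ∈ f π → τ ∈ insertBeforeRLMin (suc x) π) →
                    (∀ {π} → All (_< suc x) π → Unique (f π)) →
                    (∀ {π} → π ∈ L → π ↭ range x) → Unique L → (∀ c → Unique (rlPerms x c)) →
                    Unique (withMaxAppended x c ++ concatMap f L)
unique-extensions x c f {L} f⊆ins unique-f L↭ unique-L unique-rlPerms =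
  UniqueP.++⁺ (withMaxAppended-unique x c unique-rlPerms)
    (unique-concatMap f unique-L (λ π∈ → unique-f (<v π∈))
       (λ π∈ π′∈ τ∈ τ∈′ → insertBeforeRLMin-injective (suc x) _ _ (<v π∈) (<v π′∈) (f⊆ins τ∈) (f⊆ins τ∈′)))
    disjoint
  where
  <v : ∀ {π} → π ∈ L → All (_< suc x) π
  <v = ↭range⇒All< ∘ L↭

  disjoint : Disjoint (withMaxAppended x c) (concatMap f L)
  disjoint (τ∈appended , τ∈inserted) with find (∈-concatMap⁻ f τ∈inserted)
  ... | π , π∈ , τ∈fπ = withMaxAppended∉insertBeforeRLMin x c τ∈appended (<v π∈) (f⊆ins τ∈fπ)

rlPerms-unique : ∀ x c → Unique (rlPerms x c)
rlPerms-unique zero    zero    = [] ∷ []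
rlPerms-unique zero    (suc c) = []
rlPerms-unique (suc x) c       =
  unique-extensions x c (insertBeforeRLMin (suc x)) id (λ {π} → insertBeforeRLMin-unique (suc x) π)
    (proj₁ ∘ rlPerms-sound x c) (rlPerms-unique x c) (rlPerms-unique x)

rlAscPerms-unique : ∀ x c → Unique (rlAscPerms x c)
rlAscPerms-unique zero    zero    = [] ∷ []
rlAscPerms-unique zero    (suc c) = []
rlAscPerms-unique (suc x) c       =
  unique-extensions x c (insertBeforeInnerRLMin (suc x)) (λ {π} → insertBeforeInnerRLMin⊆insertBeforeRLMin (suc x) π)
    (λ {π} → insertBeforeInnerRLMin-unique (suc x) π) (proj₁ ∘ proj₁ ∘ rlAscPerms-sound x c) (rlAscPerms-unique x c)
    (rlPerms-unique x)

length-extensions : ∀ x c (f : List ℕ → List (List ℕ)) L k → (∀ {π} → π ∈ L → length (f π) ≡ k) →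
                    length (withMaxAppended x c ++ concatMap f L) ≡ length (withMaxAppended x c) + length L * k
length-extensions x c f L k const =
  trans (length-++ (withMaxAppended x c)) (cong (length (withMaxAppended x c) +_) (length-concatMap-const f L k const))

length-rlPerms : ∀ x c → length (rlPerms x c) ≡ S2 x c
length-rlPerms zero    zero    = refl
length-rlPerms zero    (suc c) = refl
length-rlPerms (suc x) c       = begin
  length (rlPerms (suc x) c)
    ≡⟨ length-extensions x c _ (rlPerms x c) c insertions ⟩
  length (withMaxAppended x c) + length (rlPerms x c) * c
    ≡⟨ cong₂ _+_ (appendedLength c) (cong (_* c) (length-rlPerms x c)) ⟩
  appendedCount c + S2 x c * c
    ≡⟨ recurrence c ⟩
  S2 (suc x) c
    ∎
  where
  insertions : ∀ {π} → π ∈ rlPerms x c → length (insertBeforeRLMin (suc x) π) ≡ c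
  insertions {π} π∈ = trans (length-insertBeforeRLMin (suc x) π) (proj₂ (proj₂ (rlPerms-sound x c π∈)))

  appendedCount : ℕ → ℕ
  appendedCount zero    = 0
  appendedCount (suc c) = S2 x c

  appendedLength : ∀ c → length (withMaxAppended x c) ≡ appendedCount c
  appendedLength zero    = refl
  appendedLength (suc c) = trans (length-map (_∷ʳ suc x) (rlPerms x c)) (length-rlPerms x c)

  recurrence : ∀ c → appendedCount c + S2 x c * c ≡ S2 (suc x) c
  recurrence zero    = *-zeroʳ (S2 x 0)
  recurrence (suc c) = trans (+-comm (S2 x c) _) (cong (_+ S2 x c) (*-comm (S2 x (suc c)) (suc c)))

length-rlAscPerms : ∀ x c → length (rlAscPerms (suc x) (suc c)) ≡ S2 x c + length (rlAscPerms x (suc c)) * c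
length-rlAscPerms x c =
  trans (length-extensions x (suc c) (insertBeforeInnerRLMin (suc x)) (rlAscPerms x (suc c)) c insertions)
        (cong (_+ length (rlAscPerms x (suc c)) * c) (trans (length-map (_∷ʳ suc x) (rlPerms x c)) (length-rlPerms x c)))
  where
  insertions : ∀ {π} → π ∈ rlAscPerms x (suc c) → length (insertBeforeInnerRLMin (suc x) π) ≡ c
  insertions {[]}     π∈ with () ← RLAscPerm⇒rlMinima≡ (rlAscPerms-sound x (suc c) π∈)
  insertions {y ∷ ys} π∈ = suc-injective
    (trans (length-insertBeforeInnerRLMin (suc x) y ys) (RLAscPerm⇒rlMinima≡ (rlAscPerms-sound x (suc c) π∈)))

-- Summation

∑< : ℕ → (ℕ → ℕ) → ℕ
∑< zero    f = 0
∑< (suc n) f = ∑< n f + f n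

sum-upTo : ∀ n f → sum (map f (upTo n)) ≡ ∑< n f
sum-upTo zero    f = refl
sum-upTo (suc n) f = begin
  sum (map f (upTo (suc n)))       ≡⟨ cong (sum ∘ map f) (sym (upTo-∷ʳ n)) ⟩
  sum (map f (upTo n ∷ʳ n))        ≡⟨ cong sum (map-++ f (upTo n) [ n ]) ⟩
  sum (map f (upTo n) ++ [ f n ])  ≡⟨ sum-++ (map f (upTo n)) [ f n ] ⟩
  sum (map f (upTo n)) + (f n + 0) ≡⟨ cong₂ _+_ (sum-upTo n f) (+-identityʳ (f n)) ⟩
  ∑< n f + f n                     ∎

∑<-cong : ∀ n {f g} → (∀ {i} → i < n → f i ≡ g i) → ∑< n f ≡ ∑< n g
∑<-cong zero    f≡g = refl
∑<-cong (suc n) f≡g = cong₂ _+_ (∑<-cong n (f≡g ∘ m<n⇒m<1+n)) (f≡g (n<1+n n))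

∑<-zero : ∀ n {f} → (∀ {i} → i < n → f i ≡ 0) → ∑< n f ≡ 0
∑<-zero zero    f≡0 = refl
∑<-zero (suc n) f≡0 = cong₂ _+_ (∑<-zero n (f≡0 ∘ m<n⇒m<1+n)) (f≡0 (n<1+n n))

∑<-*ˡ : ∀ n k f → ∑< n (λ i → k * f i) ≡ k * ∑< n f
∑<-*ˡ zero    k f = sym (*-zeroʳ k)
∑<-*ˡ (suc n) k f = trans (cong (_+ k * f n) (∑<-*ˡ n k f)) (sym (*-distribˡ-+ k (∑< n f) (f n)))

∑<-+ : ∀ m d f → ∑< (m + d) f ≡ ∑< m f + ∑< d (λ i → f (m + i))
∑<-+ m zero    f = trans (cong (λ n → ∑< n f) (+-identityʳ m)) (sym (+-identityʳ _))
∑<-+ m (suc d) f = begin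
  ∑< (m + suc d) f                                 ≡⟨ cong (λ n → ∑< n f) (+-suc m d) ⟩
  ∑< (m + d) f + f (m + d)                         ≡⟨ cong (_+ f (m + d)) (∑<-+ m d f) ⟩
  ∑< m f + ∑< d (λ i → f (m + i)) + f (m + d)      ≡⟨ +-assoc (∑< m f) _ _ ⟩
  ∑< m f + ∑< (suc d) (λ i → f (m + i))            ∎

sumFrom≡∑< : ∀ k n g → k ≤ n → (∀ {j} → j < k → g j ≡ 0) → sumFrom k n g ≡ ∑< n g
sumFrom≡∑< k n g k≤n g≡0 with m≤n⇒∃[o]m+o≡n k≤n
... | d , refl = begin
  sum (map (λ i → g (k + i)) (upTo (k + d ∸ k)))
    ≡⟨ cong (λ m → sum (map (λ i → g (k + i)) (upTo m))) (m+n∸m≡n k d) ⟩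
  sum (map (λ i → g (k + i)) (upTo d))
    ≡⟨ sum-upTo d _ ⟩
  ∑< d (λ i → g (k + i))
    ≡⟨ cong (_+ ∑< d (λ i → g (k + i))) (sym (∑<-zero k g≡0)) ⟩
  ∑< k g + ∑< d (λ i → g (k + i))
    ≡⟨ sym (∑<-+ k d g) ⟩
  ∑< (k + d) g
    ∎

j<k⇒S2≡0 : ∀ {j k} → j < k → S2 j k ≡ 0
j<k⇒S2≡0 {zero}  {suc k} _         = refl
j<k⇒S2≡0 {suc j} {suc k} (s≤s j<k) =
  cong₂ _+_ (trans (cong (suc k *_) (j<k⇒S2≡0 (m<n⇒m<1+n j<k))) (*-zeroʳ (suc k))) (j<k⇒S2≡0 j<k)

length-rlAscPerms≡∑< : ∀ x k → length (rlAscPerms (suc x) (suc k)) ≡ ∑< (suc x) (λ j → S2 j k * k ^ (x ∸ j))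
length-rlAscPerms≡∑< zero    k = trans (length-rlAscPerms zero k) (trans (+-identityʳ _) (sym (*-identityʳ _)))
length-rlAscPerms≡∑< (suc y) k = begin
  length (rlAscPerms (suc (suc y)) (suc k))
    ≡⟨ length-rlAscPerms (suc y) k ⟩
  S2 (suc y) k + length (rlAscPerms (suc y) (suc k)) * k
    ≡⟨ cong (λ n → S2 (suc y) k + n * k) (length-rlAscPerms≡∑< y k) ⟩
  S2 (suc y) k + ∑< (suc y) (term y) * k
    ≡⟨ +-comm (S2 (suc y) k) _ ⟩
  ∑< (suc y) (term y) * k + S2 (suc y) k
    ≡⟨ cong₂ _+_ (*-comm _ k) (sym lastTerm) ⟩
  k * ∑< (suc y) (term y) + term (suc y) (suc y)
    ≡⟨ cong (_+ term (suc y) (suc y)) (sym (∑<-*ˡ (suc y) k (term y))) ⟩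
  ∑< (suc y) (λ j → k * term y j) + term (suc y) (suc y)
    ≡⟨ cong (_+ term (suc y) (suc y)) (∑<-cong (suc y) shift) ⟩
  ∑< (suc (suc y)) (term (suc y))
    ∎
  where
  term : ℕ → ℕ → ℕ
  term x j = S2 j k * k ^ (x ∸ j)

  lastTerm : term (suc y) (suc y) ≡ S2 (suc y) k
  lastTerm = trans (cong (λ e → S2 (suc y) k * k ^ e) (n∸n≡0 y)) (*-identityʳ _)

  shift : ∀ {j} → j < suc y → k * term y j ≡ term (suc y) j
  shift {j} (s≤s j≤y) = trans (x∙yz≈y∙xz k (S2 j k) _) (cong (λ e → S2 j k * k ^ e) (sym (+-∸-assoc 1 j≤y)))

RLAscPerm⇒InI : ∀ {n c π} → RLAscPerm n c π → InI n π
RLAscPerm⇒InI {π = π} ((π↭ , rlm , _) , asc) =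
  π↭ , Equivalence.from (increasing∧val≡des⇔RLMinima∧EndsWithAscent π) (rlm , asc)

InI⇒RLAscPerm : ∀ {n π} → InI n π → RLAscPerm n (rlMinima π) π
InI⇒RLAscPerm {π = π} (π↭ , inc , eq) with Equivalence.to (increasing∧val≡des⇔RLMinima∧EndsWithAscent π) (inc , eq)
... | rlm , asc = (π↭ , rlm , refl) , asc

rlAscPerms-disjoint : ∀ n {k k′ τ} → τ ∈ rlAscPerms n (suc k) → τ ∈ rlAscPerms n (suc k′) → k ≡ k′
rlAscPerms-disjoint n {k} {k′} τ∈ τ∈′ = suc-injective (trans
  (sym (RLAscPerm⇒rlMinima≡ (rlAscPerms-sound n (suc k) τ∈)))
  (RLAscPerm⇒rlMinima≡ (rlAscPerms-sound n (suc k′) τ∈′)))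

InI⇒∈rlAscPerms : ∀ {x π} → InI (suc x) π → ∃ λ k → k < suc x × π ∈ rlAscPerms (suc x) (suc k)
InI⇒∈rlAscPerms {π = []}     (π↭ , _) with () ← ↭-length π↭
InI⇒∈rlAscPerms {x} {y ∷ ys} π-I with m≤n⇒∃[o]m+o≡n (0<rlMinima y ys) | InI⇒RLAscPerm π-I
... | k , 1+k≡ | π-rlasc@((π↭ , _ , _) , _) =
  k , subst (_≤ suc x) (sym 1+k≡) rlMinima≤n ,
  subst (λ c → y ∷ ys ∈ rlAscPerms (suc x) c) (sym 1+k≡) (rlAscPerms-complete π-rlasc)
  where
  rlMinima≤n : rlMinima (y ∷ ys) ≤ suc x
  rlMinima≤n = subst (rlMinima (y ∷ ys) ≤_) (trans (↭-length π↭) (length-range (suc x))) (rlMinima≤length (y ∷ ys))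

length-rlAscPerms≡sumFrom : ∀ x k → k < suc x →
  length (rlAscPerms (suc x) (suc k)) ≡ sumFrom k (suc x) (λ j → S2 j k * k ^ (x ∸ j))
length-rlAscPerms≡sumFrom x k k<n = trans (length-rlAscPerms≡∑< x k)
  (sym (sumFrom≡∑< k (suc x) _ (<⇒≤ k<n) (λ {j} j<k → cong (_* k ^ (x ∸ j)) (j<k⇒S2≡0 j<k))))

theorem2p8 : (n : ℕ) → n ≥ 1 → HasCard (InI n) (gould n)
theorem2p8 (suc x) _ = concatMap perms ks , unique , (λ π → mk⇔ sound complete) , count
  where
  ks : List ℕ
  ks = upTo (suc x)

  perms : ℕ → List (List ℕ)
  perms k = rlAscPerms (suc x) (suc k)

  unique : Unique (concatMap perms ks)
  unique = unique-concatMap perms (UniqueP.upTo⁺ (suc x)) (λ _ → rlAscPerms-unique (suc x) _)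
             (λ _ _ → rlAscPerms-disjoint (suc x))

  sound : ∀ {π} → π ∈ concatMap perms ks → InI (suc x) π
  sound π∈ with find (∈-concatMap⁻ perms {xs = ks} π∈)
  ... | k , _ , π∈perms = RLAscPerm⇒InI (rlAscPerms-sound (suc x) (suc k) π∈perms)

  complete : ∀ {π} → InI (suc x) π → π ∈ concatMap perms ks
  complete π-I with InI⇒∈rlAscPerms π-I
  ... | k , k<n , π∈perms = ∈-concatMap⁺ perms (lose (∈-upTo⁺ k<n) π∈perms)

  count : length (concatMap perms ks) ≡ gould (suc x)
  count = trans (length-concatMap perms ks)
                (cong sum (map-cong-local (All.tabulate (length-rlAscPerms≡sumFrom x _ ∘ ∈-upTo⁻))))
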